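{- Let $n \ge 1$ be an integer with base-$3/2$ representation $\langle n\rangle = a_k\cdots a_0$. Then $n$ is even if and only if $\sum_{i=0}^k 2^{k-i} 3^i a_i \equiv 0 \pmod{2^{k+2}}$.
   Context: Every $n \in \mathbb N=\{0,1,2,\dots\}$ has a unique expression $n = \frac12\sum_{i=0}^k a_i (3/2)^i$ with digits $a_i \in \{0,1,2\}$ and $a_k \neq 0$ if $n \ge 1$; its representation in rational base $3/2$ is the word $\langle n\rangle = a_k a_{k-1}\cdots a_0$. -}

module Defs where

open import Data.Nat using (ℕ; zero; suc; _+_; _*_; _∸_; _^_; _≤_)
open import Data.Integer using (+_)
open import Data.Rational using (ℚ; _/_) renaming (_+_ to _+ℚ_; _*_ to _*ℚ_)
import Data.Rational as ℚ
open import Relation.Binary.PropositionalEquality using (_≡_; _≢_)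

sumTo : ℕ → (ℕ → ℕ) → ℕ
sumTo zero    f = f 0
sumTo (suc k) f = sumTo k f + f (suc k)

sumToℚ : ℕ → (ℕ → ℚ) → ℚ
sumToℚ zero    f = f 0
sumToℚ (suc k) f = sumToℚ k f +ℚ f (suc k)

powℚ : ℚ → ℕ → ℚ
powℚ q zero    = ℚ.1ℚ
powℚ q (suc i) = q *ℚ powℚ q i

val32 : ℕ → (ℕ → ℕ) → ℚ
val32 k a = (+ 1 / 2) *ℚ sumToℚ k (λ i → (+ a i / 1) *ℚ powℚ (+ 3 / 2) i)

-- a_k ⋯ a_0 (digits a 0, …, a k) is the base-3/2 representation ⟨n⟩ of n ≥ 1:
-- digits in {0,1,2}, leading digit nonzero, and n = ½ Σ a_i (3/2)^i.
-- (By the uniqueness stated in the paper this determines ⟨n⟩.)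
record IsRep32 (n k : ℕ) (a : ℕ → ℕ) : Set where
  field
    digits  : ∀ i → i ≤ k → a i ≤ 2
    leading : a k ≢ 0
    value   : (+ n / 1) ≡ val32 k a

{-# OPTIONS --safe #-}
module Submission where

-- Clearing denominators: multiplying ½ Σ aᵢ (3/2)ⁱ by 2^(k+1) gives exactly
-- Σ 2^(k-i) 3ⁱ aᵢ, so this sum is n · 2^(k+1), and it is divisible by 2^(k+2)
-- precisely when 2 divides n.

open import Defs
open import Data.Nat using (ℕ; zero; suc; _+_; _*_; _∸_; _^_; _≤_; z≤n; NonZero)
open import Data.Nat.Properties
  using (*-identityˡ; *-distribˡ-+; +-comm; +-∸-assoc; n∸n≡0; ≤-refl; m≤n⇒m≤1+n; m^n≢0)
open import Data.Nat.Divisibility using (_∣_; *-monoˡ-∣; *-cancelʳ-∣)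
import Data.Nat.Solver as ℕ-Solver
open import Data.Nat.Coprimality using (1-coprimeTo) renaming (sym to coprime-sym)
open import Data.Integer using (+_)
import Data.Integer as ℤ
open import Data.Integer.Properties using (pos-*; +-injective; *-identityʳ)
open import Data.Rational using (ℚ; mkℚ; ↥_; _/_; 1ℚ) renaming (_+_ to _+ℚ_; _*_ to _*ℚ_)
open import Data.Rational.Properties using (normalize-coprime) renaming (*-identityˡ to *ℚ-identityˡ)
open import Data.Rational.Solver using (module +-*-Solver)
open import Function.Bundles using (_⇔_; mk⇔)
open import Relation.Binary.PropositionalEquality
open ≡-Reasoning

fromℕ : ℕ → ℚ
fromℕ n = + n / 1

fromℕ-normalised : ∀ n → fromℕ n ≡ mkℚ (+ n) 0 (coprime-sym (1-coprimeTo n))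
fromℕ-normalised n = normalize-coprime (coprime-sym (1-coprimeTo n))

fromℕ-homo-+ : ∀ m n → fromℕ (m + n) ≡ fromℕ m +ℚ fromℕ n
fromℕ-homo-+ m n rewrite fromℕ-normalised m | fromℕ-normalised n =
  cong (_/ 1) (sym (cong₂ ℤ._+_ (*-identityʳ (+ m)) (*-identityʳ (+ n))))

fromℕ-homo-* : ∀ m n → fromℕ (m * n) ≡ fromℕ m *ℚ fromℕ n
fromℕ-homo-* m n rewrite fromℕ-normalised m | fromℕ-normalised n = cong (_/ 1) (pos-* m n)

fromℕ-injective : ∀ {m n} → fromℕ m ≡ fromℕ n → m ≡ n
fromℕ-injective {m} {n} eq rewrite fromℕ-normalised m | fromℕ-normalised n = +-injective (cong ↥_ eq)

powℚ-cleared : ∀ r p q → r *ℚ fromℕ q ≡ fromℕ p →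
               ∀ j → powℚ r j *ℚ fromℕ (q ^ j) ≡ fromℕ (p ^ j)
powℚ-cleared r p q r*q≡p zero = refl
powℚ-cleared r p q r*q≡p (suc j) = begin
  (r *ℚ powℚ r j) *ℚ fromℕ (q * q ^ j)          ≡⟨ cong (r *ℚ powℚ r j *ℚ_) (fromℕ-homo-* q (q ^ j)) ⟩
  (r *ℚ powℚ r j) *ℚ (fromℕ q *ℚ fromℕ (q ^ j)) ≡⟨ solve 4 (λ a b c d → (a :* b) :* (c :* d) := (a :* c) :* (b :* d))
                                                       refl r (powℚ r j) (fromℕ q) (fromℕ (q ^ j)) ⟩
  (r *ℚ fromℕ q) *ℚ (powℚ r j *ℚ fromℕ (q ^ j)) ≡⟨ cong₂ _*ℚ_ r*q≡p (powℚ-cleared r p q r*q≡p j) ⟩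
  fromℕ p *ℚ fromℕ (p ^ j)                      ≡⟨ fromℕ-homo-* p (p ^ j) ⟨
  fromℕ (p * p ^ j)                             ∎
  where open +-*-Solver

sumTo-cong : ∀ k {f g : ℕ → ℕ} → (∀ i → i ≤ k → f i ≡ g i) → sumTo k f ≡ sumTo k g
sumTo-cong zero    f≗g = f≗g 0 z≤n
sumTo-cong (suc k) f≗g =
  cong₂ _+_ (sumTo-cong k (λ i i≤k → f≗g i (m≤n⇒m≤1+n i≤k))) (f≗g (suc k) ≤-refl)

sumTo-*-distribˡ : ∀ k c (f : ℕ → ℕ) → sumTo k (λ i → c * f i) ≡ c * sumTo k f
sumTo-*-distribˡ zero    c f = refl
sumTo-*-distribˡ (suc k) c f =
  trans (cong (_+ c * f (suc k)) (sumTo-*-distribˡ k c f)) (sym (*-distribˡ-+ c (sumTo k f) (f (suc k))))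

clearedDigitSum : ℕ → ℕ → (ℕ → ℕ) → ℕ → ℕ
clearedDigitSum p q a k = sumTo k (λ i → q ^ (k ∸ i) * p ^ i * a i)

clearedDigitSum-suc : ∀ p q a k →
  clearedDigitSum p q a (suc k) ≡ q * clearedDigitSum p q a k + p ^ suc k * a (suc k)
clearedDigitSum-suc p q a k = cong₂ _+_ earlierTerms lastTerm
  where
  open ℕ-Solver.+-*-Solver

  earlierTerm : ∀ i → i ≤ k → q ^ (suc k ∸ i) * p ^ i * a i ≡ q * (q ^ (k ∸ i) * p ^ i * a i)
  earlierTerm i i≤k = begin
    q ^ (suc k ∸ i) * p ^ i * a i     ≡⟨ cong (λ e → q ^ e * p ^ i * a i) (+-∸-assoc 1 i≤k) ⟩
    q * q ^ (k ∸ i) * p ^ i * a i     ≡⟨ solve 4 (λ x y z w → x :* y :* z :* w := x :* (y :* z :* w))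
                                            refl q (q ^ (k ∸ i)) (p ^ i) (a i) ⟩
    q * (q ^ (k ∸ i) * p ^ i * a i)   ∎

  earlierTerms : sumTo k (λ i → q ^ (suc k ∸ i) * p ^ i * a i) ≡ q * clearedDigitSum p q a k
  earlierTerms = trans (sumTo-cong k earlierTerm) (sumTo-*-distribˡ k q (λ i → q ^ (k ∸ i) * p ^ i * a i))

  lastTerm : q ^ (k ∸ k) * p ^ suc k * a (suc k) ≡ p ^ suc k * a (suc k)
  lastTerm rewrite n∸n≡0 k = cong (_* a (suc k)) (*-identityˡ (p ^ suc k))

digitSum-cleared : ∀ r p q → r *ℚ fromℕ q ≡ fromℕ p → ∀ a k →
  sumToℚ k (λ i → fromℕ (a i) *ℚ powℚ r i) *ℚ fromℕ (q ^ k) ≡ fromℕ (clearedDigitSum p q a k)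
digitSum-cleared r p q r*q≡p a zero = begin
  (fromℕ (a 0) *ℚ 1ℚ) *ℚ 1ℚ  ≡⟨ solve 1 (λ x → (x :* con 1ℚ) :* con 1ℚ := x) refl (fromℕ (a 0)) ⟩
  fromℕ (a 0)                ≡⟨ cong fromℕ (*-identityˡ (a 0)) ⟨
  fromℕ (1 * 1 * a 0)        ∎
  where open +-*-Solver
digitSum-cleared r p q r*q≡p a (suc k) = begin
  (T +ℚ fromℕ A *ℚ powℚ r (suc k)) *ℚ fromℕ (q * q ^ k)
    ≡⟨ cong ((T +ℚ fromℕ A *ℚ powℚ r (suc k)) *ℚ_) (fromℕ-homo-* q (q ^ k)) ⟩
  (T +ℚ fromℕ A *ℚ powℚ r (suc k)) *ℚ (fromℕ q *ℚ fromℕ (q ^ k))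
    ≡⟨ solve 5 (λ t x y c d → (t :+ x :* y) :* (c :* d) := c :* (t :* d) :+ (y :* (c :* d)) :* x)
         refl T (fromℕ A) (powℚ r (suc k)) (fromℕ q) (fromℕ (q ^ k)) ⟩
  fromℕ q *ℚ (T *ℚ fromℕ (q ^ k)) +ℚ (powℚ r (suc k) *ℚ (fromℕ q *ℚ fromℕ (q ^ k))) *ℚ fromℕ A
    ≡⟨ cong (λ z → fromℕ q *ℚ (T *ℚ fromℕ (q ^ k)) +ℚ (powℚ r (suc k) *ℚ z) *ℚ fromℕ A)
            (fromℕ-homo-* q (q ^ k)) ⟨
  fromℕ q *ℚ (T *ℚ fromℕ (q ^ k)) +ℚ (powℚ r (suc k) *ℚ fromℕ (q ^ suc k)) *ℚ fromℕ A
    ≡⟨ cong₂ (λ u v → fromℕ q *ℚ u +ℚ v *ℚ fromℕ A)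
             (digitSum-cleared r p q r*q≡p a k) (powℚ-cleared r p q r*q≡p (suc k)) ⟩
  fromℕ q *ℚ fromℕ (clearedDigitSum p q a k) +ℚ fromℕ (p ^ suc k) *ℚ fromℕ A
    ≡⟨ cong₂ _+ℚ_ (fromℕ-homo-* q (clearedDigitSum p q a k)) (fromℕ-homo-* (p ^ suc k) A) ⟨
  fromℕ (q * clearedDigitSum p q a k) +ℚ fromℕ (p ^ suc k * A)
    ≡⟨ fromℕ-homo-+ (q * clearedDigitSum p q a k) (p ^ suc k * A) ⟨
  fromℕ (q * clearedDigitSum p q a k + p ^ suc k * A)
    ≡⟨ cong fromℕ (clearedDigitSum-suc p q a k) ⟨
  fromℕ (clearedDigitSum p q a (suc k)) ∎
  where
  open +-*-Solver
  T = sumToℚ k (λ i → fromℕ (a i) *ℚ powℚ r i)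
  A = a (suc k)

val32-cleared : ∀ n k a → fromℕ n ≡ val32 k a → n * 2 ^ suc k ≡ clearedDigitSum 3 2 a k
val32-cleared n k a n≡val = fromℕ-injective (begin
  fromℕ (n * (2 * 2 ^ k))                 ≡⟨ fromℕ-homo-* n (2 * 2 ^ k) ⟩
  fromℕ n *ℚ fromℕ (2 * 2 ^ k)            ≡⟨ cong₂ _*ℚ_ n≡val (fromℕ-homo-* 2 (2 ^ k)) ⟩
  (½ *ℚ T) *ℚ (fromℕ 2 *ℚ fromℕ (2 ^ k))  ≡⟨ solve 4 (λ h t c d → (h :* t) :* (c :* d) := (h :* c) :* (t :* d))
                                                refl ½ T (fromℕ 2) (fromℕ (2 ^ k)) ⟩
  (½ *ℚ fromℕ 2) *ℚ (T *ℚ fromℕ (2 ^ k))  ≡⟨ cong (1ℚ *ℚ_) (digitSum-cleared (+ 3 / 2) 3 2 refl a k) ⟩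
  1ℚ *ℚ fromℕ (clearedDigitSum 3 2 a k)   ≡⟨ *ℚ-identityˡ _ ⟩
  fromℕ (clearedDigitSum 3 2 a k)         ∎)
  where
  open +-*-Solver
  ½ = + 1 / 2
  T = sumToℚ k (λ i → fromℕ (a i) *ℚ powℚ (+ 3 / 2) i)

∣⇔*-∣-* : ∀ {m n} o .{{_ : NonZero o}} → m ∣ n ⇔ m * o ∣ n * o
∣⇔*-∣-* o = mk⇔ (*-monoˡ-∣ o) (*-cancelʳ-∣ o)

-- Only the value equation of the representation is needed.
proposition21 : (n : ℕ) → 1 ≤ n → (k : ℕ) → (a : ℕ → ℕ) → IsRep32 n k a →
    (2 ∣ n) ⇔ (2 ^ (k + 2) ∣ sumTo k (λ i → 2 ^ (k ∸ i) * 3 ^ i * a i))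
proposition21 n _ k a rep =
  subst₂ (λ d s → (2 ∣ n) ⇔ (d ∣ s))
         (cong (2 ^_) (+-comm 2 k))
         (val32-cleared n k a (IsRep32.value rep))
         (∣⇔*-∣-* (2 ^ suc k) {{m^n≢0 2 (suc k)}})
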